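{- Let $E$ be an equivalence relation on $\mathbb N$. If $E^+\leq E$, then $E^{+a}\leq E$ for every $a\in\mathcal O$.
   Context: $E\leq F$ means there is a total computable $f$ with $x\mathrel{E}y\iff f(x)\mathrel{F}f(y)$. $\phi_e$ is the $e$-th partial computable function. The computable FS-jump $E^+$ is the equivalence relation on $\mathbb N$ with $e\mathrel{E^+}e'$ iff $\{[\phi_e(n)]_E:\phi_e(n)\downarrow\}=\{[\phi_{e'}(n)]_E:\phi_{e'}(n)\downarrow\}$. Kleene's $\mathcal O$: $1\in\mathcal O$; if $b\in\mathcal O$ then $2^b\in\mathcal O$; if $\phi_e$ is total with values in $\mathcal O$ increasing in the $\mathcal O$-order, then $3\cdot5^e\in\mathcal O$. Transfinite jumps are defined by recursion: $E^{+1}=E$, $E^{+2^b}=(E^{+b})^+$, and $E^{+3\cdot5^e}=\{(\langle m,x\rangle,\langle n,y\rangle):m=n\text{ and }x\mathrel{E^{+\phi_e(m)}}y\}$, where $\langle\cdot,\cdot\rangle$ is the standard pairing function. -}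

module Defs where

open import Level using (0ℓ)
open import Data.Nat using (ℕ; zero; suc; _+_; _*_; _^_; _/_; _%_; _≡ᵇ_)
open import Data.Bool using (if_then_else_)
open import Data.Product using (_×_; _,_; Σ; ∃; proj₁; proj₂)
open import Relation.Binary.Core using (Rel)
open import Relation.Binary.PropositionalEquality using (_≡_)
open import Function.Bundles using (_⇔_)

pair : ℕ → ℕ → ℕ
pair x y = ((x + y) * suc (x + y)) / 2 + y

-- inverse of pair, computed by walking the Cantor enumeration
-- (0,0), (1,0), (0,1), (2,0), (1,1), (0,2), ...
unpair : ℕ → ℕ × ℕ
unpair zero = 0 , 0
unpair (suc n) with unpair n
... | zero  , y = suc y , 0
... | suc x , y = x , suc y

-- A Gödel numbering of the partial recursive functions (unary, with
-- tuples coded by the pairing function).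

data Code : Set where
  zeroC identC succC fstC sndC : Code
  pairC compC recC             : Code → Code → Code
  muC                          : Code → Code

data _⊢_⇓_ : Code → ℕ → ℕ → Set
data MuFrom (f : Code) (x : ℕ) : ℕ → ℕ → Set

data _⊢_⇓_ where
  zero⇓  : ∀ {n} → zeroC ⊢ n ⇓ 0
  ident⇓ : ∀ {n} → identC ⊢ n ⇓ n
  succ⇓  : ∀ {n} → succC ⊢ n ⇓ suc n
  fst⇓   : ∀ {n} → fstC ⊢ n ⇓ proj₁ (unpair n)
  snd⇓   : ∀ {n} → sndC ⊢ n ⇓ proj₂ (unpair n)
  pair⇓  : ∀ {f g n u v} → f ⊢ n ⇓ u → g ⊢ n ⇓ v → pairC f g ⊢ n ⇓ pair u v
  comp⇓  : ∀ {f g n u v} → g ⊢ n ⇓ u → f ⊢ u ⇓ v → compC f g ⊢ n ⇓ v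
  recz⇓  : ∀ {f g n x v} → unpair n ≡ (x , 0) → f ⊢ x ⇓ v → recC f g ⊢ n ⇓ v
  recs⇓  : ∀ {f g n x y w v} → unpair n ≡ (x , suc y) →
           recC f g ⊢ pair x y ⇓ w → g ⊢ pair (pair x y) w ⇓ v →
           recC f g ⊢ n ⇓ v
  mu⇓    : ∀ {f x y} → MuFrom f x 0 y → muC f ⊢ x ⇓ y

data MuFrom f x where
  found : ∀ {z} → f ⊢ pair x z ⇓ 0 → MuFrom f x z z
  next  : ∀ {z y v} → f ⊢ pair x z ⇓ suc v → MuFrom f x (suc z) y → MuFrom f x z y

-- decoding numbers to codes (surjective); fuel bounds the depth
decodeTag : (ℕ → ℕ → Code) → ℕ → ℕ → Code
decodeTag d 0 r = zeroC
decodeTag d 1 r = identC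
decodeTag d 2 r = succC
decodeTag d 3 r = fstC
decodeTag d 4 r = sndC
decodeTag d 5 r = pairC (d (proj₁ (unpair r)) 0) (d (proj₂ (unpair r)) 0)
decodeTag d 6 r = compC (d (proj₁ (unpair r)) 0) (d (proj₂ (unpair r)) 0)
decodeTag d 7 r = recC (d (proj₁ (unpair r)) 0) (d (proj₂ (unpair r)) 0)
decodeTag d _ r = muC (d r 0)

decodeAux : ℕ → ℕ → Code
decodeAux zero    m = zeroC
decodeAux (suc k) m = decodeTag (λ i _ → decodeAux k i) (m % 9) (m / 9)

decode : ℕ → Code
decode e = decodeAux e e

φ_[_]⇓_ : ℕ → ℕ → ℕ → Set
φ e [ n ]⇓ v = decode e ⊢ n ⇓ v

Computable : (ℕ → ℕ) → Set
Computable f = ∃ λ e → ∀ n → φ e [ n ]⇓ f n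

_≤c_ : Rel ℕ 0ℓ → Rel ℕ 0ℓ → Set
E ≤c F = ∃ λ (f : ℕ → ℕ) → Computable f × (∀ x y → E x y ⇔ F (f x) (f y))

_⁺ : Rel ℕ 0ℓ → Rel ℕ 0ℓ
(E ⁺) e e' =
  (∀ n v → φ e [ n ]⇓ v → ∃ λ n' → ∃ λ v' → φ e' [ n' ]⇓ v' × E v v')
  × (∀ n' v' → φ e' [ n' ]⇓ v' → ∃ λ n → ∃ λ v → φ e [ n ]⇓ v × E v v')

data _≺_ : ℕ → ℕ → Set where
  ≺suc : ∀ {b} → b ≺ (2 ^ b)
  ≺lim : ∀ {e n v} → φ e [ n ]⇓ v → v ≺ (3 * 5 ^ e)

data _<ₒ_ : ℕ → ℕ → Set where
  step  : ∀ {a b} → a ≺ b → a <ₒ b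
  trans : ∀ {a b c} → a <ₒ b → b <ₒ c → a <ₒ c

data 𝒪 : ℕ → Set where
  one : 𝒪 1
  sucO : ∀ {b} → 𝒪 b → 𝒪 (2 ^ b)
  limO : ∀ e (f : ℕ → ℕ) → (∀ m → φ e [ m ]⇓ f m) → (∀ m → 𝒪 (f m)) →
         (∀ m → f m <ₒ f (suc m)) → 𝒪 (3 * 5 ^ e)

jump : Rel ℕ 0ℓ → ∀ {a} → 𝒪 a → Rel ℕ 0ℓ
jump E one = E
jump E (sucO p) = (jump E p) ⁺
jump E (limO e f _ o _) a b =
  proj₁ (unpair a) ≡ proj₁ (unpair b) ×
  jump E (o (proj₁ (unpair a))) (proj₂ (unpair a)) (proj₂ (unpair b))

module Submission where

-- Fix a computable reduction r of E⁺ to E.  Using the recursion theorem we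
-- build a single index P whose function H a x = φ_P ⟨a , x⟩ satisfies
--   H 1 x       = x,
--   H (2^b) x   = r ⌜φ_{H b} ∘ φ_x⌝               (the set enumerated by x, pushed through H b),
--   H (3·5^e) x = ⟪tag m , r ⌜{H (φ_e m) y}⌝⟫     for x = ⟨m , y⟩,
-- where ⌜…⌝ denotes an index computed from the data, tag m is an E-class
-- determined by m, and ⟪_,_⟫ is a Kuratowski pair formed with r.  Since
-- E⁺ ≤ E, E can code singletons and two-element sets, hence ordered pairs,
-- and distinct numbers get E-inequivalent tags.  By induction on a ∈ 𝒪,
-- x ↦ H a x reduces E^{+a} to E; the successor step rests on the fact that
-- composing enumerations with a reduction transports the FS-jump.

open import Defs hiding (trans)
open import Level using (0ℓ)
open import Data.Nat
open import Data.Nat.Properties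
open import Data.Nat.DivMod
open import Data.Nat.Divisibility using (divides-refl)
open import Data.Product
open import Data.Empty using (⊥; ⊥-elim)
open import Data.Sum using (_⊎_; inj₁; inj₂; [_,_]′; reduce)
open import Relation.Binary.PropositionalEquality
open import Relation.Binary.Core using (Rel)
open import Relation.Binary.Structures using (IsEquivalence)
open import Function.Bundles using (_⇔_; mk⇔; Equivalence)
import Function.Properties.Equivalence as ⇔
open import Data.Nat.Tactic.RingSolver using (solve-∀)

triangle : ℕ → ℕ
triangle zero = zero
triangle (suc s) = suc s + triangle s

triangle-double : ∀ s → s * suc s ≡ triangle s * 2
triangle-double zero = refl
triangle-double (suc s) = begin
  suc s * suc (suc s)              ≡⟨ expand s ⟩
  s * suc s + suc s * 2            ≡⟨ cong (_+ suc s * 2) (triangle-double s) ⟩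
  triangle s * 2 + suc s * 2       ≡⟨ +-comm (triangle s * 2) (suc s * 2) ⟩
  suc s * 2 + triangle s * 2       ≡⟨ *-distribʳ-+ 2 (suc s) (triangle s) ⟨
  (suc s + triangle s) * 2         ∎
  where
  open ≡-Reasoning
  expand : ∀ s → suc s * suc (suc s) ≡ s * suc s + suc s * 2
  expand = solve-∀

pair-triangle : ∀ x y → pair x y ≡ triangle (x + y) + y
pair-triangle x y =
  cong (_+ y) (trans (cong (_/ 2) (triangle-double (x + y))) (m*n/n≡m (triangle (x + y)) 2))

pair-next-on-diagonal : ∀ x y → pair x (suc y) ≡ suc (pair (suc x) y)
pair-next-on-diagonal x y rewrite pair-triangle x (suc y) | pair-triangle (suc x) y | +-suc x y =
  +-suc (triangle (suc (x + y))) y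

pair-next-diagonal : ∀ y → pair (suc y) 0 ≡ suc (pair 0 y)
pair-next-diagonal y rewrite pair-triangle (suc y) 0 | pair-triangle 0 y | +-identityʳ y
                           | +-identityʳ (y + triangle y) =
  cong suc (+-comm y (triangle y))

unpair-pair : ∀ x y → unpair (pair x y) ≡ (x , y)
unpair-pair x y = on-diagonal (x + y) x y refl
  where
  on-diagonal : ∀ s x y → x + y ≡ s → unpair (pair x y) ≡ (x , y)
  on-diagonal s zero zero eq = refl
  on-diagonal zero (suc x) zero ()
  on-diagonal (suc s) (suc x) zero eq
    rewrite pair-next-diagonal x
          | on-diagonal s zero x (cong pred (trans (cong suc (sym (+-identityʳ x))) eq)) = refl
  on-diagonal s x (suc y) eq
    rewrite pair-next-on-diagonal x y | on-diagonal s (suc x) y (trans (sym (+-suc x y)) eq) = refl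

-- The components of n are bounded by n, so decoding only recurses on smaller numbers.
unpair-bound : ∀ n → proj₁ (unpair n) + proj₂ (unpair n) ≤ n
unpair-bound zero = z≤n
unpair-bound (suc n) with unpair n | unpair-bound n
... | zero  , y | b = s≤s (subst (_≤ n) (sym (+-identityʳ y)) b)
... | suc x , y | b = subst (_≤ suc n) (sym (+-suc x y)) (m≤n⇒m≤1+n b)

π₁ π₂ : ℕ → ℕ
π₁ n = proj₁ (unpair n)
π₂ n = proj₂ (unpair n)

π₁-pair : ∀ x y → π₁ (pair x y) ≡ x
π₁-pair x y = cong proj₁ (unpair-pair x y)

π₂-pair : ∀ x y → π₂ (pair x y) ≡ y
π₂-pair x y = cong proj₂ (unpair-pair x y)

π₁-bound : ∀ n → π₁ n ≤ n
π₁-bound n = ≤-trans (m≤m+n _ _) (unpair-bound n)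

π₂-bound : ∀ n → π₂ n ≤ n
π₂-bound n = ≤-trans (m≤n+m _ _) (unpair-bound n)

-- decode e reads a tag (e mod 9) and components (e div 9); the fuel argument
-- of decodeAux is irrelevant once it bounds the number being decoded, so
-- decode commutes with the tag structure.

decodeTag-cong : ∀ d d' t r → (∀ i → i ≤ r → d i 0 ≡ d' i 0) → decodeTag d t r ≡ decodeTag d' t r
decodeTag-cong d d' 0 r h = refl
decodeTag-cong d d' 1 r h = refl
decodeTag-cong d d' 2 r h = refl
decodeTag-cong d d' 3 r h = refl
decodeTag-cong d d' 4 r h = refl
decodeTag-cong d d' 5 r h = cong₂ pairC (h _ (π₁-bound r)) (h _ (π₂-bound r))
decodeTag-cong d d' 6 r h = cong₂ compC (h _ (π₁-bound r)) (h _ (π₂-bound r))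
decodeTag-cong d d' 7 r h = cong₂ recC (h _ (π₁-bound r)) (h _ (π₂-bound r))
decodeTag-cong d d' (suc (suc (suc (suc (suc (suc (suc (suc t)))))))) r h = cong muC (h r ≤-refl)

decodeAux-fuel : ∀ k k' m → m ≤ k → m ≤ k' → decodeAux k m ≡ decodeAux k' m
decodeAux-fuel zero    zero     zero _ _ = refl
decodeAux-fuel zero    (suc k') zero _ _ = refl
decodeAux-fuel (suc k) zero     zero _ _ = refl
decodeAux-fuel (suc k) (suc k') zero _ _ = refl
decodeAux-fuel (suc k) (suc k') (suc m) (s≤s m≤k) (s≤s m≤k') =
  decodeTag-cong _ _ (suc m % 9) (suc m / 9) λ i i≤ →
    let i≤m = ≤-pred (≤-trans (s≤s i≤) (m/n<m (suc m) 9 (s≤s (s≤s z≤n))))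
    in decodeAux-fuel k k' i (≤-trans i≤m m≤k) (≤-trans i≤m m≤k')

tagged : ℕ → ℕ → ℕ
tagged k q = suc k + q * 9

decode-tagged : ∀ k q → k < 8 → decode (tagged k q) ≡ decodeTag (λ i _ → decode i) (suc k) q
decode-tagged k q k<8 = begin
    decodeTag (λ i _ → decodeAux (k + q * 9) i) (tagged k q % 9) (tagged k q / 9)
      ≡⟨ cong₂ (decodeTag (λ i _ → decodeAux (k + q * 9) i)) tag-mod tag-div ⟩
    decodeTag (λ i _ → decodeAux (k + q * 9) i) (suc k) q
      ≡⟨ decodeTag-cong _ _ (suc k) q (λ i i≤q → decodeAux-fuel _ _ i (≤-trans i≤q q≤fuel) ≤-refl) ⟩
    decodeTag (λ i _ → decode i) (suc k) q ∎
  where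
  open ≡-Reasoning
  tag-mod : tagged k q % 9 ≡ suc k
  tag-mod = trans ([m+kn]%n≡m%n (suc k) q 9) (m<n⇒m%n≡m (s≤s k<8))
  tag-div : tagged k q / 9 ≡ q
  tag-div = trans (+-distrib-/-∣ʳ (suc k) (divides-refl q))
                  (cong₂ _+_ (m<n⇒m/n≡0 (s≤s k<8)) (m*n/n≡m q 9))
  q≤fuel : q ≤ k + q * 9
  q≤fuel = ≤-trans (m≤m*n q 9) (m≤n+m _ k)

-- The pairing function behind an opaque alias, so that indices built from it
-- stay symbolic instead of being normalised during type checking.
opaque
  pairᵒ : ℕ → ℕ → ℕ
  pairᵒ = pair

  pairᵒ≡pair : ∀ x y → pairᵒ x y ≡ pair x y
  pairᵒ≡pair x y = refl

idxPair idxComp idxRec : ℕ → ℕ → ℕ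
idxPair i j = tagged 4 (pairᵒ i j)
idxComp i j = tagged 5 (pairᵒ i j)
idxRec  i j = tagged 6 (pairᵒ i j)

idxMu : ℕ → ℕ
idxMu i = tagged 7 i

decode-idxPair : ∀ i j → decode (idxPair i j) ≡ pairC (decode i) (decode j)
decode-idxPair i j rewrite pairᵒ≡pair i j | decode-tagged 4 (pair i j) (m≤m+n 5 3) | unpair-pair i j = refl

decode-idxComp : ∀ i j → decode (idxComp i j) ≡ compC (decode i) (decode j)
decode-idxComp i j rewrite pairᵒ≡pair i j | decode-tagged 5 (pair i j) (m≤m+n 6 2) | unpair-pair i j = refl

decode-idxRec : ∀ i j → decode (idxRec i j) ≡ recC (decode i) (decode j)
decode-idxRec i j rewrite pairᵒ≡pair i j | decode-tagged 6 (pair i j) (m≤m+n 7 1) | unpair-pair i j = refl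

decode-idxMu : ∀ i → decode (idxMu i) ≡ muC (decode i)
decode-idxMu i rewrite decode-tagged 7 i ≤-refl = refl

encode : Code → ℕ
encode zeroC = 0
encode identC = 1
encode succC = 2
encode fstC = 3
encode sndC = 4
encode (pairC a b) = idxPair (encode a) (encode b)
encode (compC a b) = idxComp (encode a) (encode b)
encode (recC a b) = idxRec (encode a) (encode b)
encode (muC a) = idxMu (encode a)

decode-encode : ∀ c → decode (encode c) ≡ c
decode-encode zeroC = refl
decode-encode identC = refl
decode-encode succC = refl
decode-encode fstC = refl
decode-encode sndC = refl
decode-encode (pairC a b) =
  trans (decode-idxPair (encode a) (encode b)) (cong₂ pairC (decode-encode a) (decode-encode b))
decode-encode (compC a b) =
  trans (decode-idxComp (encode a) (encode b)) (cong₂ compC (decode-encode a) (decode-encode b))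
decode-encode (recC a b) =
  trans (decode-idxRec (encode a) (encode b)) (cong₂ recC (decode-encode a) (decode-encode b))
decode-encode (muC a) = trans (decode-idxMu (encode a)) (cong muC (decode-encode a))

⇓-det : ∀ {c n v w} → c ⊢ n ⇓ v → c ⊢ n ⇓ w → v ≡ w
mu-det : ∀ {f x z y y'} → MuFrom f x z y → MuFrom f x z y' → y ≡ y'
⇓-det zero⇓ zero⇓ = refl
⇓-det ident⇓ ident⇓ = refl
⇓-det succ⇓ succ⇓ = refl
⇓-det fst⇓ fst⇓ = refl
⇓-det snd⇓ snd⇓ = refl
⇓-det (pair⇓ a b) (pair⇓ a' b') = cong₂ pair (⇓-det a a') (⇓-det b b')
⇓-det (comp⇓ g₁ f₁) (comp⇓ g₂ f₂) with ⇓-det g₁ g₂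
... | refl = ⇓-det f₁ f₂
⇓-det (recz⇓ e₁ a) (recz⇓ e₂ b) with trans (sym e₁) e₂
... | refl = ⇓-det a b
⇓-det (recz⇓ e₁ a) (recs⇓ e₂ _ _) with trans (sym e₁) e₂
... | ()
⇓-det (recs⇓ e₁ _ _) (recz⇓ e₂ _) with trans (sym e₁) e₂
... | ()
⇓-det (recs⇓ e₁ r₁ g₁) (recs⇓ e₂ r₂ g₂) with trans (sym e₁) e₂
... | refl with ⇓-det r₁ r₂
... | refl = ⇓-det g₁ g₂
⇓-det (mu⇓ a) (mu⇓ b) = mu-det a b
mu-det (found a) (found b) = refl
mu-det (found a) (next b _) with ⇓-det a b
... | ()
mu-det (next a _) (found b) with ⇓-det a b
... | ()
mu-det (next _ a) (next _ b) = mu-det a b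

infix 4 _≈>_
_≈>_ : Code → (ℕ → ℕ) → Set
c ≈> F = ∀ n → c ⊢ n ⇓ F n

⇓-≡ : ∀ {c n v w} → c ⊢ n ⇓ v → v ≡ w → c ⊢ n ⇓ w
⇓-≡ d refl = d

zero≈> : zeroC ≈> λ _ → 0
zero≈> n = zero⇓

id≈> : identC ≈> λ n → n
id≈> n = ident⇓

succ≈> : succC ≈> suc
succ≈> n = succ⇓

fst≈> : fstC ≈> π₁
fst≈> n = fst⇓

snd≈> : sndC ≈> π₂
snd≈> n = snd⇓

comp≈> : ∀ {f g F G} → f ≈> F → g ≈> G → compC f g ≈> λ n → F (G n)
comp≈> a b n = comp⇓ (b n) (a _)

rec-computes : ∀ {f g F} (S : ℕ → ℕ → ℕ → ℕ) (h : ℕ → ℕ) {x} →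
               f ≈> F → g ≈> (λ n → S (π₁ (π₁ n)) (π₂ (π₁ n)) (π₂ n)) →
               F x ≡ h 0 → (∀ y → S x y (h y) ≡ h (suc y)) →
               ∀ y → recC f g ⊢ pair x y ⇓ h y
rec-computes S h {x} f≈> g≈> base-eq step-eq zero = recz⇓ (unpair-pair x 0) (⇓-≡ (f≈> x) base-eq)
rec-computes S h {x} f≈> g≈> base-eq step-eq (suc y) =
  recs⇓ (unpair-pair x (suc y)) (rec-computes S h f≈> g≈> base-eq step-eq y)
        (⇓-≡ (g≈> _) (trans at-pair (step-eq y)))
  where
  at-pair : S (π₁ (π₁ (pair (pair x y) (h y)))) (π₂ (π₁ (pair (pair x y) (h y)))) (π₂ (pair (pair x y) (h y)))
            ≡ S x y (h y)
  at-pair rewrite π₁-pair (pair x y) (h y) | π₂-pair (pair x y) (h y) | π₁-pair x y | π₂-pair x y = refl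

urec : Code → Code → Code
urec f g = compC (recC f g) (pairC zeroC identC)

urec-computes : ∀ {f g F} (S : ℕ → ℕ → ℕ) (h : ℕ → ℕ) → f ≈> F → g ≈> (λ n → S (π₂ (π₁ n)) (π₂ n)) →
                F 0 ≡ h 0 → (∀ y → S y (h y) ≡ h (suc y)) → urec f g ≈> h
urec-computes S h f≈> g≈> base-eq step-eq n =
  comp⇓ (pair⇓ zero⇓ ident⇓) (rec-computes (λ _ → S) h f≈> g≈> base-eq step-eq n)

Computes₂ : Code → (ℕ → ℕ → ℕ) → Set
Computes₂ c B = ∀ x y → c ⊢ pair x y ⇓ B x y

app₂≈> : ∀ {c B f g F G} → Computes₂ c B → f ≈> F → g ≈> G → compC c (pairC f g) ≈> λ n → B (F n) (G n)
app₂≈> h a b n = comp⇓ (pair⇓ (a n) (b n)) (h _ _)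

K : ℕ → Code
K zero = zeroC
K (suc k) = compC succC (K k)

K≈> : ∀ k → K k ≈> λ _ → k
K≈> zero n = zero⇓
K≈> (suc k) n = comp⇓ (K≈> k n) succ⇓

K-output : ∀ {k n v} → K k ⊢ n ⇓ v → v ≡ k
K-output {k} {n} d = ⇓-det d (K≈> k n)

addC : Code
addC = recC identC (compC succC sndC)

add₂ : Computes₂ addC _+_
add₂ x = rec-computes (λ _ _ p → suc p) (x +_) id≈> (comp≈> succ≈> snd≈>)
                      (sym (+-identityʳ x)) (λ y → sym (+-suc x y))

mulC : Code
mulC = recC zeroC (compC addC (pairC sndC (compC fstC fstC)))

mul₂ : Computes₂ mulC _*_
mul₂ x = rec-computes (λ x _ p → p + x) (x *_) zero≈> (app₂≈> add₂ snd≈> (comp≈> fst≈> fst≈>))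
                      (sym (*-zeroʳ x)) (λ y → trans (+-comm (x * y) x) (sym (*-suc x y)))

predC : Code
predC = urec zeroC (compC sndC fstC)

pred≈> : predC ≈> pred
pred≈> = urec-computes (λ y _ → y) pred zero≈> (comp≈> snd≈> fst≈>) refl (λ _ → refl)

monusC : Code
monusC = recC identC (compC predC sndC)

monus₂ : Computes₂ monusC _∸_
monus₂ x = rec-computes (λ _ _ p → pred p) (x ∸_) id≈> (comp≈> pred≈> snd≈>) refl (pred[m∸n]≡m∸[1+n] x)

powC : ℕ → Code
powC b = urec (K 1) (compC mulC (pairC (K b) sndC))

pow≈> : ∀ b → powC b ≈> λ k → b ^ k
pow≈> b = urec-computes (λ _ p → b * p) (b ^_) (K≈> 1) (app₂≈> mul₂ (K≈> b) snd≈>) refl (λ _ → refl)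

triangleC : Code
triangleC = urec zeroC (compC addC (pairC (compC succC (compC sndC fstC)) sndC))

triangle≈> : triangleC ≈> triangle
triangle≈> = urec-computes (λ y p → suc y + p) triangle zero≈>
                           (app₂≈> add₂ (comp≈> succ≈> (comp≈> snd≈> fst≈>)) snd≈>) refl (λ _ → refl)

pairingC : Code
pairingC = compC addC (pairC (compC triangleC (compC addC (pairC fstC sndC))) sndC)

pairing₂ : Computes₂ pairingC pairᵒ
pairing₂ x y = ⇓-≡ (app₂≈> add₂ (comp≈> triangle≈> (app₂≈> add₂ fst≈> snd≈>)) snd≈> (pair x y)) (begin
  triangle (π₁ (pair x y) + π₂ (pair x y)) + π₂ (pair x y)
    ≡⟨ cong₂ (λ u w → triangle (u + w) + w) (π₁-pair x y) (π₂-pair x y) ⟩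
  triangle (x + y) + y    ≡⟨ pair-triangle x y ⟨
  pair x y                ≡⟨ pairᵒ≡pair x y ⟨
  pairᵒ x y               ∎)
  where open ≡-Reasoning

-- A small language of total programs: each expression compiles to a program
-- computing its meaning, so programs can be written as terms over the input.
data Expr : Set where
  input : Expr
  lit   : ℕ → Expr
  app₁  : (c : Code) (F : ℕ → ℕ) → c ≈> F → Expr → Expr
  app₂  : (c : Code) (B : ℕ → ℕ → ℕ) → Computes₂ c B → Expr → Expr → Expr

compile : Expr → Code
compile input = identC
compile (lit k) = K k
compile (app₁ c F h e) = compC c (compile e)
compile (app₂ c B h e₁ e₂) = compC c (pairC (compile e₁) (compile e₂))

⟦_⟧ : Expr → ℕ → ℕ
⟦ input ⟧ n = n
⟦ lit k ⟧ n = k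
⟦ app₁ c F h e ⟧ n = F (⟦ e ⟧ n)
⟦ app₂ c B h e₁ e₂ ⟧ n = B (⟦ e₁ ⟧ n) (⟦ e₂ ⟧ n)

compile≈> : ∀ e → compile e ≈> ⟦ e ⟧
compile≈> input = id≈>
compile≈> (lit k) = K≈> k
compile≈> (app₁ c F h e) = comp≈> h (compile≈> e)
compile≈> (app₂ c B h e₁ e₂) = app₂≈> h (compile≈> e₁) (compile≈> e₂)

Fst Snd : Expr → Expr
Fst = app₁ fstC π₁ fst≈>
Snd = app₁ sndC π₂ snd≈>

infixl 6 _⊕_ _⊖_
infixl 7 _⊛_
_⊕_ _⊛_ _⊖_ : Expr → Expr → Expr
_⊕_ = app₂ addC _+_ add₂
_⊛_ = app₂ mulC _*_ mul₂
_⊖_ = app₂ monusC _∸_ monus₂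

⟪_,_⟫ : Expr → Expr → Expr
⟪_,_⟫ = app₂ pairingC pairᵒ pairing₂

IdxPair IdxComp IdxRec : Expr → Expr → Expr
IdxPair i j = lit 5 ⊕ ⟪ i , j ⟫ ⊛ lit 9
IdxComp i j = lit 6 ⊕ ⟪ i , j ⟫ ⊛ lit 9
IdxRec  i j = lit 7 ⊕ ⟪ i , j ⟫ ⊛ lit 9

constIdx : ℕ → ℕ
constIdx k = encode (K k)

constIdx≈> : urec zeroC (compile (IdxComp (lit 2) (Snd input))) ≈> constIdx
constIdx≈> = urec-computes (λ _ p → idxComp 2 p) constIdx zero≈> (compile≈> (IdxComp (lit 2) (Snd input)))
                           refl (λ _ → refl)

ConstIdx : Expr → Expr
ConstIdx = app₁ _ constIdx constIdx≈>

decode-constIdx : ∀ k → decode (constIdx k) ≡ K k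
decode-constIdx k = decode-encode (K k)

-- |x - y| and two case distinctions used to tell notations apart:
-- isOne a = 1 iff a = 1, and isOdd separates 2^b (even) from 3·5^e (odd).

diff : ℕ → ℕ → ℕ
diff x y = (x ∸ y) + (y ∸ x)

Diff : Expr → Expr → Expr
Diff x y = (x ⊖ y) ⊕ (y ⊖ x)

diff-refl : ∀ x → diff x x ≡ 0
diff-refl x rewrite n∸n≡0 x = refl

diff≢0 : ∀ {x y} → x ≢ y → diff x y ≢ 0
diff≢0 {x} {y} x≢y d =
  x≢y (≤-antisym (m∸n≡0⇒m≤n (m+n≡0⇒m≡0 (x ∸ y) d)) (m∸n≡0⇒m≤n (m+n≡0⇒n≡0 (x ∸ y) d)))

isOne : ℕ → ℕ
isOne a = 1 ∸ diff a 1

IsOne : Expr → Expr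
IsOne a = lit 1 ⊖ Diff a (lit 1)

isOne-≥2 : ∀ a → 2 ≤ a → isOne a ≡ 0
isOne-≥2 (suc zero) (s≤s ())
isOne-≥2 (suc (suc a)) _ = 0∸n≡0 (a + (1 ∸ suc (suc a)))

isOdd : ℕ → ℕ
isOdd zero = 0
isOdd (suc n) = 1 ∸ isOdd n

isOddC : Code
isOddC = urec zeroC (compC monusC (pairC (K 1) sndC))

isOdd≈> : isOddC ≈> isOdd
isOdd≈> = urec-computes (λ _ p → 1 ∸ p) isOdd zero≈> (app₂≈> monus₂ (K≈> 1) snd≈>) refl (λ _ → refl)

IsOdd : Expr → Expr
IsOdd = app₁ isOddC isOdd isOdd≈>

isOdd-even : ∀ k → isOdd (k + k) ≡ 0
isOdd-even zero = refl
isOdd-even (suc k) rewrite +-suc k k | isOdd-even k = refl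

isOdd-2^ : ∀ b → isOdd (2 ^ suc b) ≡ 0
isOdd-2^ b rewrite +-identityʳ (2 ^ b) = isOdd-even (2 ^ b)

5^-odd : ∀ e → ∃ λ k → 5 ^ e ≡ suc (k + k)
5^-odd zero = 0 , refl
5^-odd (suc e) with 5^-odd e
... | k , eq = 2 + 5 * k , trans (cong (5 *_) eq) (five-times k)
  where
  five-times : ∀ k → 5 * suc (k + k) ≡ suc ((2 + 5 * k) + (2 + 5 * k))
  five-times = solve-∀

3·odd : ∀ k → 3 * suc (k + k) ≡ suc ((1 + 3 * k) + (1 + 3 * k))
3·odd = solve-∀

isOdd-3·5^ : ∀ e → isOdd (3 * 5 ^ e) ≡ 1
isOdd-3·5^ e with 5^-odd e
... | k , eq = begin
  isOdd (3 * 5 ^ e)                           ≡⟨ cong (λ n → isOdd (3 * n)) eq ⟩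
  isOdd (3 * suc (k + k))                     ≡⟨ cong isOdd (3·odd k) ⟩
  isOdd (suc ((1 + 3 * k) + (1 + 3 * k)))     ≡⟨ cong (1 ∸_) (isOdd-even (1 + 3 * k)) ⟩
  1                                           ∎
  where open ≡-Reasoning

-- Notations other than 1 are at least 2, so isOne vanishes on them.
2≤2^ : ∀ b → 2 ≤ 2 ^ suc b
2≤2^ b = *-monoʳ-≤ 2 (m^n>0 2 b)

2≤3·5^ : ∀ e → 2 ≤ 3 * 5 ^ e
2≤3·5^ e = ≤-trans (s≤s (s≤s z≤n)) (*-monoʳ-≤ 3 (m^n>0 5 e))

select : ℕ → ℕ → ℕ → ℕ → ℕ → ℕ
select i q x v w = i * x + (1 ∸ i) * ((1 ∸ q) * v + q * w)

Select : Expr → Expr → Expr → Expr → Expr → Expr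
Select i q x v w = i ⊛ x ⊕ (lit 1 ⊖ i) ⊛ ((lit 1 ⊖ q) ⊛ v ⊕ q ⊛ w)

select-1 : ∀ q x v w → select 1 q x v w ≡ x
select-1 q x v w = trans (+-identityʳ (1 * x)) (*-identityˡ x)

select-0-0 : ∀ x v w → select 0 0 x v w ≡ v
select-0-0 = identity
  where
  identity : ∀ x v w → 0 * x + 1 * (1 * v + 0 * w) ≡ v
  identity = solve-∀

select-0-1 : ∀ x v w → select 0 1 x v w ≡ w
select-0-1 = identity
  where
  identity : ∀ x v w → 0 * x + 1 * (0 * v + 1 * w) ≡ w
  identity = solve-∀

search : (ℕ → ℕ) → ℕ → ℕ → ℕ
search t z zero = z
search t z (suc f) with t z
... | zero  = z
... | suc _ = search t (suc z) f

search-mu : ∀ {c t} → c ≈> t → ∀ x z f → t (pair x (z + f)) ≡ 0 →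
            MuFrom c x z (search (λ k → t (pair x k)) z f)
search-mu {t = t} h x z zero e = found (⇓-≡ (h _) (trans (cong (λ w → t (pair x w)) (sym (+-identityʳ z))) e))
search-mu {t = t} h x z (suc f) e with t (pair x z) in eq
... | zero  = found (⇓-≡ (h _) eq)
... | suc v = next (⇓-≡ (h _) eq) (search-mu h x (suc z) f (trans (cong (λ w → t (pair x w)) (sym (+-suc z f))) e))

search-least : ∀ t z f b → z ≤ b → b ≤ z + f → t b ≡ 0 → (∀ k → z ≤ k → k < b → t k ≢ 0) →
               search t z f ≡ b
search-least t z zero b z≤b b≤ tb nz = ≤-antisym z≤b (subst (b ≤_) (+-identityʳ z) b≤)
search-least t z (suc f) b z≤b b≤ tb nz with t z in eq | m≤n⇒m<n∨m≡n z≤b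
... | zero  | inj₂ z≡b = z≡b
... | zero  | inj₁ z<b = ⊥-elim (nz z ≤-refl z<b eq)
... | suc v | inj₂ refl = ⊥-elim (1+n≢0 (trans (sym eq) tb))
... | suc v | inj₁ z<b =
  search-least t (suc z) f b z<b (subst (b ≤_) (+-suc z f) b≤) tb
               (λ k sz≤k k<b → nz k (≤-trans (n≤1+n z) sz≤k) k<b)

-- Inverting a computable function g: on input a, search for the least k with
-- g k = a or k ≥ a.  The test on ⟨a , k⟩ is |g k - a| · (a ∸ k).
InverseTest : Expr → Expr
InverseTest g = Diff g (Fst input) ⊛ (Fst input ⊖ Snd input)

inverse : Expr → ℕ → ℕ
inverse g a = search (λ k → ⟦ InverseTest g ⟧ (pair a k)) 0 a

inverse≈> : ∀ g → muC (compile (InverseTest g)) ≈> inverse g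
inverse≈> g a = mu⇓ (search-mu (compile≈> (InverseTest g)) a 0 a stops)
  where
  stops : ⟦ InverseTest g ⟧ (pair a a) ≡ 0
  stops rewrite π₁-pair a a | π₂-pair a a | n∸n≡0 a = *-zeroʳ (diff (⟦ g ⟧ (pair a a)) a)

inverse-correct : ∀ g (G : ℕ → ℕ) → (∀ n → ⟦ g ⟧ n ≡ G (π₂ n)) → (∀ {k b} → k < b → G k < G b) →
                  ∀ b → b < G b → inverse g (G b) ≡ b
inverse-correct g G g≡G G-mono b b<Gb = search-least _ 0 (G b) b z≤n (<⇒≤ b<Gb) hit miss
  where
  hit : ⟦ InverseTest g ⟧ (pair (G b) b) ≡ 0
  hit rewrite g≡G (pair (G b) b) | π₁-pair (G b) b | π₂-pair (G b) b | diff-refl (G b) = refl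
  miss : ∀ k → 0 ≤ k → k < b → ⟦ InverseTest g ⟧ (pair (G b) k) ≢ 0
  miss k _ k<b rewrite g≡G (pair (G b) k) | π₁-pair (G b) k | π₂-pair (G b) k = λ prod≡0 →
    [ diff≢0 (<⇒≢ (G-mono k<b)) , (λ e → <⇒≱ (<-trans k<b b<Gb) (m∸n≡0⇒m≤n e)) ]′
      (m*n≡0⇒m≡0∨n≡0 _ prod≡0)

-- Exponentials outgrow their exponent, which bounds the inverting searches below.
n<b^n : ∀ b → 1 < b → ∀ n → n < b ^ n
n<b^n b 1<b zero = s≤s z≤n
n<b^n (suc b) 1<b (suc n) = ≤-trans (s≤s (n<b^n (suc b) 1<b n)) (grow (suc b ^ n) (m^n>0 (suc b) n))
  where
  grow : ∀ m → 0 < m → suc m ≤ suc b * m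
  grow m 0<m = begin
    suc m        ≡⟨ +-comm 1 m ⟩
    m + 1        ≤⟨ +-monoʳ-≤ m 0<m ⟩
    m + m        ≡⟨ cong (m +_) (+-identityʳ m) ⟨
    2 * m        ≤⟨ *-monoˡ-≤ m 1<b ⟩
    suc b * m    ∎
    where open ≤-Reasoning

Pow2 Pow35 : Expr
Pow2 = app₁ (powC 2) (2 ^_) (pow≈> 2) (Snd input)
Pow35 = lit 3 ⊛ app₁ (powC 5) (5 ^_) (pow≈> 5) (Snd input)

log₂ : ℕ → ℕ
log₂ = inverse Pow2

log₅ : ℕ → ℕ
log₅ = inverse Pow35

Log₂ Log₅ : Expr → Expr
Log₂ = app₁ (muC (compile (InverseTest Pow2))) log₂ (inverse≈> Pow2)
Log₅ = app₁ (muC (compile (InverseTest Pow35))) log₅ (inverse≈> Pow35)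

log₂-2^ : ∀ b → log₂ (2 ^ b) ≡ b
log₂-2^ b = inverse-correct Pow2 (2 ^_) (λ n → refl) (^-monoʳ-< 2 (s≤s (s≤s z≤n))) b
                            (n<b^n 2 (s≤s (s≤s z≤n)) b)

log₅-3·5^ : ∀ e → log₅ (3 * 5 ^ e) ≡ e
log₅-3·5^ e = inverse-correct Pow35 (λ k → 3 * 5 ^ k) (λ n → refl)
                              (λ k<b → *-monoʳ-< 3 (^-monoʳ-< 5 (s≤s (s≤s z≤n)) k<b)) e
                              (≤-trans (n<b^n 5 (s≤s (s≤s z≤n)) e) (m≤n*m (5 ^ e) 3))

-- curryIdx p b is an index of z ↦ φ_p ⟨b , z⟩ (the s-m-n function).
curryIdx : ℕ → ℕ → ℕ
curryIdx p b = idxComp p (idxPair (constIdx b) 1)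

CurryIdx : Expr → Expr → Expr
CurryIdx p b = IdxComp p (IdxPair (ConstIdx b) (lit 1))

decode-curryIdx : ∀ p b → decode (curryIdx p b) ≡ compC (decode p) (pairC (K b) identC)
decode-curryIdx p b =
  trans (decode-idxComp p (idxPair (constIdx b) 1))
        (cong (compC (decode p)) (trans (decode-idxPair (constIdx b) 1) (cong₂ pairC (decode-constIdx b) refl)))

curryIdx-⇓ : ∀ {p b z v} → decode p ⊢ pair b z ⇓ v → φ curryIdx p b [ z ]⇓ v
curryIdx-⇓ {p} {b} {z} {v} d =
  subst (λ c → c ⊢ z ⇓ v) (sym (decode-curryIdx p b)) (comp⇓ (pair⇓ (K≈> b z) ident⇓) d)

-- Kleene's recursion theorem for total programs: for every program G there is
-- an index P with φ_P z = G ⟨P , z⟩.  P = curryIdx s s, where s is an index of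
-- ⟨y , z⟩ ↦ G ⟨curryIdx y y , z⟩.
opaque
  recursion-theorem : ∀ {G g} → G ≈> g → ∃ λ P → decode P ≈> λ z → g (pair P z)
  recursion-theorem {G} {g} G≈>g = curryIdx s s , λ z → curryIdx-⇓ {s} {s} (self-application z)
    where
    Self : Code
    Self = compC G (pairC (compC (compile (CurryIdx input input)) fstC) sndC)
    s : ℕ
    s = encode Self
    self-application : ∀ z → decode s ⊢ pair s z ⇓ g (pair (curryIdx s s) z)
    self-application z =
      subst (λ c → c ⊢ pair s z ⇓ g (pair (curryIdx s s) z)) (sym (decode-encode Self))
        (comp⇓ (pair⇓ (comp⇓ fst⇓ (compile≈> (CurryIdx input input) _)) snd⇓)
               (⇓-≡ (G≈>g _) (cong₂ (λ y w → g (pair (curryIdx y y) w)) (π₁-pair s z) (π₂-pair s z))))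

record Enumerates₂ (i A B : ℕ) : Set where
  constructor enumerates
  field
    range : ∀ n v → φ i [ n ]⇓ v → v ≡ A ⊎ v ≡ B
    hitsA : ∃ λ n → φ i [ n ]⇓ A
    hitsB : ∃ λ n → φ i [ n ]⇓ B

enumerates-constant : ∀ {i A} → (∀ n v → φ i [ n ]⇓ v → v ≡ A) → φ i [ 0 ]⇓ A → Enumerates₂ i A A
enumerates-constant range-A hit = enumerates (λ n v d → inj₁ (range-A n v d)) (0 , hit) (0 , hit)

constIdx-enumerates : ∀ A → Enumerates₂ (constIdx A) A A
constIdx-enumerates A =
  enumerates-constant (λ n v d → K-output (subst (λ c → c ⊢ n ⇓ v) (decode-constIdx A) d))
                      (subst (λ c → c ⊢ 0 ⇓ A) (sym (decode-constIdx A)) (K≈> A 0))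

-- pairIdx A B is an index of ⟨x , 0⟩ ↦ A, ⟨x , y+1⟩ ↦ B, whose range is {A , B}.
pairIdx : ℕ → ℕ → ℕ
pairIdx A B = idxRec (constIdx A) (constIdx B)

PairIdx : Expr → Expr → Expr
PairIdx A B = IdxRec (ConstIdx A) (ConstIdx B)

pairIdx-enumerates : ∀ A B → Enumerates₂ (pairIdx A B) A B
pairIdx-enumerates A B = enumerates range (0 , into (recz⇓ refl (K≈> A 0)))
                                        (2 , into (recs⇓ refl (recz⇓ refl (K≈> A 0)) (K≈> B _)))
  where
  decode-pairIdx : decode (pairIdx A B) ≡ recC (K A) (K B)
  decode-pairIdx =
    trans (decode-idxRec (constIdx A) (constIdx B)) (cong₂ recC (decode-constIdx A) (decode-constIdx B))
  into : ∀ {n v} → recC (K A) (K B) ⊢ n ⇓ v → φ pairIdx A B [ n ]⇓ v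
  into {n} {v} = subst (λ c → c ⊢ n ⇓ v) (sym decode-pairIdx)
  range : ∀ n v → φ pairIdx A B [ n ]⇓ v → v ≡ A ⊎ v ≡ B
  range n v d with subst (λ c → c ⊢ n ⇓ v) decode-pairIdx d
  ... | recz⇓ _ k = inj₁ (K-output k)
  ... | recs⇓ _ _ k = inj₂ (K-output k)

emptyIdx : ℕ
emptyIdx = encode (muC succC)

emptyIdx-diverges : ∀ n v → φ emptyIdx [ n ]⇓ v → ⊥
emptyIdx-diverges n v d with subst (λ c → c ⊢ n ⇓ v) (decode-encode (muC succC)) d
... | mu⇓ m = never m
  where
  never : ∀ {x z y} → MuFrom succC x z y → ⊥
  never (found ())
  never (next _ m) = never m

module _ {q} {h : ℕ → ℕ} (q-computes : ∀ u → φ q [ u ]⇓ h u) where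

  idxComp-⇓ : ∀ {x n u} → φ x [ n ]⇓ u → φ idxComp q x [ n ]⇓ h u
  idxComp-⇓ {x} {n} {u} d = subst (λ c → c ⊢ n ⇓ h u) (sym (decode-idxComp q x)) (comp⇓ d (q-computes u))

  idxComp-⇑ : ∀ {x n v} → φ idxComp q x [ n ]⇓ v → ∃ λ u → φ x [ n ]⇓ u × v ≡ h u
  idxComp-⇑ {x} {n} {v} d with subst (λ c → c ⊢ n ⇓ v) (decode-idxComp q x) d
  ... | comp⇓ {u = u} dx dq = u , dx , ⇓-det dq (q-computes u)

module Jump (E : Rel ℕ 0ℓ) where

  -- {A , B} and {A' , B'} have the same E-saturation, spelled out.
  SameSet₂ : ℕ → ℕ → ℕ → ℕ → Set
  SameSet₂ A B A' B' = ((E A A' ⊎ E A B') × (E B A' ⊎ E B B')) × ((E A A' ⊎ E B A') × (E A B' ⊎ E B B'))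

  ⁺-two : ∀ {i j A B A' B'} → Enumerates₂ i A B → Enumerates₂ j A' B' → (E ⁺) i j ⇔ SameSet₂ A B A' B'
  ⁺-two {i} {j} {A} {B} {A'} {B'} (enumerates range-i (nA , dA) (nB , dB))
                                 (enumerates range-j (nA' , dA') (nB' , dB')) = mk⇔ forth back
    where
    in-j : ∀ {v} → (∃ λ n → ∃ λ w → φ j [ n ]⇓ w × E v w) → E v A' ⊎ E v B'
    in-j (n , w , d , e) = [ (λ { refl → inj₁ e }) , (λ { refl → inj₂ e }) ]′ (range-j n w d)
    in-i : ∀ {v} → (∃ λ n → ∃ λ w → φ i [ n ]⇓ w × E w v) → E A v ⊎ E B v
    in-i (n , w , d , e) = [ (λ { refl → inj₁ e }) , (λ { refl → inj₂ e }) ]′ (range-i n w d)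
    hit-j : ∀ {v} → E v A' ⊎ E v B' → ∃ λ n → ∃ λ w → φ j [ n ]⇓ w × E v w
    hit-j (inj₁ e) = nA' , A' , dA' , e
    hit-j (inj₂ e) = nB' , B' , dB' , e
    hit-i : ∀ {v} → E A v ⊎ E B v → ∃ λ n → ∃ λ w → φ i [ n ]⇓ w × E w v
    hit-i (inj₁ e) = nA , A , dA , e
    hit-i (inj₂ e) = nB , B , dB , e
    forth : (E ⁺) i j → SameSet₂ A B A' B'
    forth (l , r) = (in-j (l nA A dA) , in-j (l nB B dB)) , (in-i (r nA' A' dA') , in-i (r nB' B' dB'))
    back : SameSet₂ A B A' B' → (E ⁺) i j
    back ((a , b) , (a' , b')) =
      (λ n v d → [ (λ { refl → hit-j a }) , (λ { refl → hit-j b }) ]′ (range-i n v d)) ,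
      (λ n v d → [ (λ { refl → hit-i a' }) , (λ { refl → hit-i b' }) ]′ (range-j n v d))

  ⁺-transport : (R : Rel ℕ 0ℓ) (h : ℕ → ℕ) → (∀ u u' → R u u' ⇔ E (h u) (h u')) →
                (C : ℕ → ℕ) → (∀ {x n u} → φ x [ n ]⇓ u → φ C x [ n ]⇓ h u) →
                (∀ {x n v} → φ C x [ n ]⇓ v → ∃ λ u → φ x [ n ]⇓ u × v ≡ h u) →
                ∀ x y → (R ⁺) x y ⇔ (E ⁺) (C x) (C y)
  ⁺-transport R h h-reduces C C-⇓ C-⇑ x y =
    mk⇔ (λ (l , r) → push l (λ {u} {u'} → Equivalence.to (h-reduces u u')) ,
                     push r (λ {u} {u'} → Equivalence.to (h-reduces u' u)))
        (λ (l , r) → pull l (λ {u} {u'} → Equivalence.from (h-reduces u u')) ,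
                     pull r (λ {u} {u'} → Equivalence.from (h-reduces u' u)))
    where
    -- one half of the jump, for an arbitrary orientation S / T of the relations
    push : ∀ {x y} {S T : Rel ℕ 0ℓ} →
           (∀ n u → φ x [ n ]⇓ u → ∃ λ n' → ∃ λ u' → φ y [ n' ]⇓ u' × S u u') →
           (∀ {u u'} → S u u' → T (h u) (h u')) →
           ∀ n v → φ C x [ n ]⇓ v → ∃ λ n' → ∃ λ v' → φ C y [ n' ]⇓ v' × T v v'
    push half S⇒T n v d with C-⇑ d
    ... | u , dx , refl with half n u dx
    ... | n' , u' , dy , s = n' , h u' , C-⇓ dy , S⇒T s
    pull : ∀ {x y} {S T : Rel ℕ 0ℓ} →
           (∀ n v → φ C x [ n ]⇓ v → ∃ λ n' → ∃ λ v' → φ C y [ n' ]⇓ v' × T v v') →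
           (∀ {u u'} → T (h u) (h u') → S u u') →
           ∀ n u → φ x [ n ]⇓ u → ∃ λ n' → ∃ λ u' → φ y [ n' ]⇓ u' × S u u'
    pull half T⇒S n u dx with half n (h u) (C-⇓ dx)
    ... | n' , v' , d' , t with C-⇑ d'
    ... | u' , dy , refl = n' , u' , dy , T⇒S t

-- limitIdx p e x is an index of the constant function with value
-- φ_p ⟨φ_e (π₁ x) , π₂ x⟩; for total φ_e and φ_p it enumerates a singleton.
limitIdx : ℕ → ℕ → ℕ → ℕ
limitIdx p e x = idxComp p (idxPair (idxComp e (constIdx (π₁ x))) (constIdx (π₂ x)))

LimitIdx : Expr → Expr → Expr → Expr
LimitIdx p e x = IdxComp p (IdxPair (IdxComp e (ConstIdx (Fst x))) (ConstIdx (Snd x)))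

limitIdx-enumerates : ∀ {p e} {f : ℕ → ℕ} {h : ℕ → ℕ → ℕ} →
                      (∀ m → φ e [ m ]⇓ f m) → Computes₂ (decode p) h →
                      ∀ x → Enumerates₂ (limitIdx p e x) (h (f (π₁ x)) (π₂ x)) (h (f (π₁ x)) (π₂ x))
limitIdx-enumerates {p} {e} {f} {h} e-total p-total x =
  enumerates-constant range (subst (λ c → c ⊢ 0 ⇓ h (f (π₁ x)) (π₂ x)) (sym decode-limitIdx)
                                   (comp⇓ (pair⇓ (comp⇓ (K≈> (π₁ x) 0) (e-total (π₁ x))) (K≈> (π₂ x) 0))
                                          (p-total (f (π₁ x)) (π₂ x))))
  where
  decode-limitIdx :
    decode (limitIdx p e x) ≡ compC (decode p) (pairC (compC (decode e) (K (π₁ x))) (K (π₂ x)))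
  decode-limitIdx = begin
    decode (limitIdx p e x)
      ≡⟨ decode-idxComp p (idxPair (idxComp e (constIdx (π₁ x))) (constIdx (π₂ x))) ⟩
    compC (decode p) (decode (idxPair (idxComp e (constIdx (π₁ x))) (constIdx (π₂ x))))
      ≡⟨ cong (compC (decode p)) (decode-idxPair (idxComp e (constIdx (π₁ x))) (constIdx (π₂ x))) ⟩
    compC (decode p) (pairC (decode (idxComp e (constIdx (π₁ x)))) (decode (constIdx (π₂ x))))
      ≡⟨ cong₂ (λ a b → compC (decode p) (pairC a b))
               (decode-idxComp e (constIdx (π₁ x))) (decode-constIdx (π₂ x)) ⟩
    compC (decode p) (pairC (compC (decode e) (decode (constIdx (π₁ x)))) (K (π₂ x)))
      ≡⟨ cong (λ c → compC (decode p) (pairC (compC (decode e) c) (K (π₂ x)))) (decode-constIdx (π₁ x)) ⟩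
    compC (decode p) (pairC (compC (decode e) (K (π₁ x))) (K (π₂ x))) ∎
    where open ≡-Reasoning
  range : ∀ n v → φ limitIdx p e x [ n ]⇓ v → v ≡ h (f (π₁ x)) (π₂ x)
  range n v d with subst (λ c → c ⊢ n ⇓ v) decode-limitIdx d
  ... | comp⇓ (pair⇓ (comp⇓ k₁ dₑ) k₂) dₚ with K-output k₁ | K-output k₂
  ... | refl | refl with ⇓-det dₑ (e-total (π₁ x))
  ... | refl = ⇓-det dₚ (p-total (f (π₁ x)) (π₂ x))

module Hierarchy (r : ℕ → ℕ) (rC : Code) (r≈> : rC ≈> r) where

  Ap-r : Expr → Expr
  Ap-r = app₁ rC r r≈>

  -- r applied to indices of {A} , {A , B} and of the Kuratowski pair {{A} , {A , B}}.
  single : ℕ → ℕ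
  single A = r (constIdx A)

  double : ℕ → ℕ → ℕ
  double A B = r (pairIdx A B)

  kpair : ℕ → ℕ → ℕ
  kpair A B = double (single A) (double A B)

  Single : Expr → Expr
  Single A = Ap-r (ConstIdx A)

  Double : Expr → Expr → Expr
  Double A B = Ap-r (PairIdx A B)

  KPair : Expr → Expr → Expr
  KPair A B = Double (Single A) (Double A B)

  tag : ℕ → ℕ
  tag zero = r emptyIdx
  tag (suc m) = single (tag m)

  tag≈> : urec (compile (Ap-r (lit emptyIdx))) (compile (Single (Snd input))) ≈> tag
  tag≈> = urec-computes (λ _ p → single p) tag (compile≈> (Ap-r (lit emptyIdx))) (compile≈> (Single (Snd input)))
                        refl (λ _ → refl)

  Tag : Expr → Expr
  Tag = app₁ _ tag tag≈>

  -- One stage of the construction, for a candidate index p of H: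
  -- x at a = 1, r ⌜φ_{H b} ∘ φ_x⌝ at a = 2^b, ⟪tag m , r ⌜{H (φ_e m) y}⌝⟫ at a = 3·5^e, x = ⟨m , y⟩.
  stage : ℕ → ℕ → ℕ → ℕ
  stage p a x = select (isOne a) (isOdd a) x (r (idxComp (curryIdx p (log₂ a)) x))
                                            (kpair (tag (π₁ x)) (r (limitIdx p (log₅ a) x)))

  Stage : Expr
  Stage = Select (IsOne a) (IsOdd a) x (Ap-r (IdxComp (CurryIdx p (Log₂ a)) x))
                                      (KPair (Tag (Fst x)) (Ap-r (LimitIdx p (Log₅ a) x)))
    where
    p = Fst input
    a = Fst (Snd input)
    x = Snd (Snd input)

  P : ℕ
  P = proj₁ (recursion-theorem (compile≈> Stage))

  H : ℕ → ℕ → ℕ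
  H = stage P

  H-computes : Computes₂ (decode P) H
  H-computes a x = ⇓-≡ (proj₂ (recursion-theorem (compile≈> Stage)) (pair a x)) (begin
    stage (π₁ (pair P (pair a x))) (π₁ (π₂ (pair P (pair a x)))) (π₂ (π₂ (pair P (pair a x))))
      ≡⟨ cong₂ (λ p z → stage p (π₁ z) (π₂ z)) (π₁-pair P (pair a x)) (π₂-pair P (pair a x)) ⟩
    stage P (π₁ (pair a x)) (π₂ (pair a x))
      ≡⟨ cong₂ (stage P) (π₁-pair a x) (π₂-pair a x) ⟩
    stage P a x ∎)
    where open ≡-Reasoning

  H-index : ∀ a n → φ curryIdx P a [ n ]⇓ H a n
  H-index a n = curryIdx-⇓ {P} {a} (H-computes a n)

  H-1 : ∀ x → H 1 x ≡ x
  H-1 x = select-1 (isOdd 1) x (r (idxComp (curryIdx P (log₂ 1)) x))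
                                (kpair (tag (π₁ x)) (r (limitIdx P (log₅ 1) x)))

  H-2^ : ∀ b → 1 ≤ b → ∀ x → H (2 ^ b) x ≡ r (idxComp (curryIdx P b) x)
  H-2^ (suc b) _ x = begin
    H (2 ^ suc b) x
      ≡⟨ cong₂ (λ i q → select i q x succ-case lim-case) (isOne-≥2 _ (2≤2^ b)) (isOdd-2^ b) ⟩
    select 0 0 x succ-case lim-case
      ≡⟨ select-0-0 x succ-case lim-case ⟩
    r (idxComp (curryIdx P (log₂ (2 ^ suc b))) x)
      ≡⟨ cong (λ c → r (idxComp (curryIdx P c) x)) (log₂-2^ (suc b)) ⟩
    r (idxComp (curryIdx P (suc b)) x) ∎
    where
    open ≡-Reasoning
    succ-case = r (idxComp (curryIdx P (log₂ (2 ^ suc b))) x)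
    lim-case = kpair (tag (π₁ x)) (r (limitIdx P (log₅ (2 ^ suc b)) x))

  H-3·5^ : ∀ e x → H (3 * 5 ^ e) x ≡ kpair (tag (π₁ x)) (r (limitIdx P e x))
  H-3·5^ e x = begin
    H (3 * 5 ^ e) x
      ≡⟨ cong₂ (λ i q → select i q x succ-case lim-case) (isOne-≥2 _ (2≤3·5^ e)) (isOdd-3·5^ e) ⟩
    select 0 1 x succ-case lim-case
      ≡⟨ select-0-1 x succ-case lim-case ⟩
    kpair (tag (π₁ x)) (r (limitIdx P (log₅ (3 * 5 ^ e)) x))
      ≡⟨ cong (λ c → kpair (tag (π₁ x)) (r (limitIdx P c x))) (log₅-3·5^ e) ⟩
    kpair (tag (π₁ x)) (r (limitIdx P e x)) ∎
    where
    open ≡-Reasoning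
    succ-case = r (idxComp (curryIdx P (log₂ (3 * 5 ^ e))) x)
    lim-case = kpair (tag (π₁ x)) (r (limitIdx P (log₅ (3 * 5 ^ e)) x))

-- Notations are positive, so 2^b ∈ 𝒪 never collides with 1.
𝒪-positive : ∀ {a} → 𝒪 a → 1 ≤ a
𝒪-positive one = s≤s z≤n
𝒪-positive (sucO {b} _) = m^n>0 2 b
𝒪-positive (limO e _ _ _ _) = ≤-trans (s≤s z≤n) (2≤3·5^ e)

module Reduction (E : Rel ℕ 0ℓ) (E-equiv : IsEquivalence E) (r : ℕ → ℕ) (rIdx : ℕ)
                 (r-computes : ∀ n → φ rIdx [ n ]⇓ r n) (r-reduces : ∀ x y → (E ⁺) x y ⇔ E (r x) (r y)) where

  open IsEquivalence E-equiv renaming (refl to E-refl; sym to E-sym; trans to E-trans)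
  open Equivalence using (to; from)
  open Jump E
  open Hierarchy r (decode rIdx) r-computes

  r-two : ∀ {i j A B A' B'} → Enumerates₂ i A B → Enumerates₂ j A' B' → E (r i) (r j) ⇔ SameSet₂ A B A' B'
  r-two ei ej = ⇔.trans (⇔.sym (r-reduces _ _)) (⁺-two ei ej)

  sameSet-pointwise : ∀ {A B A' B'} → E A A' → E B B' → SameSet₂ A B A' B'
  sameSet-pointwise a b = (inj₁ a , inj₂ b) , (inj₁ a , inj₂ b)

  r-one : ∀ {i j A A'} → Enumerates₂ i A A → Enumerates₂ j A' A' → E (r i) (r j) ⇔ E A A'
  r-one ei ej = ⇔.trans (r-two ei ej) (mk⇔ (λ ((a , _) , _) → reduce a) (λ a → sameSet-pointwise a a))

  single-iff : ∀ {A A'} → E (single A) (single A') ⇔ E A A'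
  single-iff {A} {A'} = r-one (constIdx-enumerates A) (constIdx-enumerates A')

  double-iff : ∀ {A B A' B'} → E (double A B) (double A' B') ⇔ SameSet₂ A B A' B'
  double-iff {A} {B} {A'} {B'} = r-two (pairIdx-enumerates A B) (pairIdx-enumerates A' B')

  single~double : ∀ {X C D} → E (single X) (double C D) → E X C × E X D
  single~double {X} {C} {D} e with to (r-two (constIdx-enumerates X) (pairIdx-enumerates C D)) e
  ... | _ , (c , d) = reduce c , reduce d

  double~single : ∀ {X C D} → E (double C D) (single X) → E C X × E D X
  double~single {X} {C} {D} e with single~double {X} {C} {D} (E-sym e)
  ... | c , d = E-sym c , E-sym d

  -- The second coordinate of a Kuratowski pair, once the first is known: B is
  -- related to A' or B', B' to A or B, and the mixed case goes through A ~ A'.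
  second-coordinate : ∀ {A B A' B'} → E A A' → E B A' ⊎ E B B' → E A B' ⊎ E B B' → E B B'
  second-coordinate _ (inj₂ b) _ = b
  second-coordinate _ (inj₁ _) (inj₂ b) = b
  second-coordinate a (inj₁ ba') (inj₁ ab') = E-trans ba' (E-trans (E-sym a) ab')

  kpair-iff : ∀ {A B A' B'} → E (kpair A B) (kpair A' B') ⇔ (E A A' × E B B')
  kpair-iff {A} {B} {A'} {B'} = mk⇔ decompose compose
    where
    compose : E A A' × E B B' → E (kpair A B) (kpair A' B')
    compose (a , b) =
      from (double-iff {single A} {double A B} {single A'} {double A' B'})
           (sameSet-pointwise (from (single-iff {A} {A'}) a)
                              (from (double-iff {A} {B} {A'} {B'}) (sameSet-pointwise a b)))
    decompose : E (kpair A B) (kpair A' B') → E A A' × E B B'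
    decompose e with to (double-iff {single A} {double A B} {single A'} {double A' B'}) e
    ... | (s , d) , (_ , d') = a , second-coordinate a (B-in d) (B'-in d')
      where
      a : E A A'
      a = [ to (single-iff {A} {A'}) , (λ x → proj₁ (single~double {A} {A'} {B'} x)) ]′ s
      B-in : E (double A B) (single A') ⊎ E (double A B) (double A' B') → E B A' ⊎ E B B'
      B-in = [ (λ x → inj₁ (proj₂ (double~single {A'} {A} {B} x)))
             , (λ x → proj₂ (proj₁ (to (double-iff {A} {B} {A'} {B'}) x))) ]′
      B'-in : E (single A) (double A' B') ⊎ E (double A B) (double A' B') → E A B' ⊎ E B B'
      B'-in = [ (λ x → inj₁ (proj₂ (single~double {A} {A'} {B'} x)))
              , (λ x → proj₂ (proj₂ (to (double-iff {A} {B} {A'} {B'}) x))) ]′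

  -- Distinct numbers have E-inequivalent tags: r of the empty set is not
  -- equivalent to r of a singleton, and singletons are injective.
  empty≁single : ∀ {A} → E (r emptyIdx) (single A) → ⊥
  empty≁single {A} e =
    let (n , v , d , _) = proj₂ (from (r-reduces emptyIdx (constIdx A)) e) 0 A constIdx-at-0
    in emptyIdx-diverges n v d
    where
    constIdx-at-0 : φ constIdx A [ 0 ]⇓ A
    constIdx-at-0 = proj₂ (Enumerates₂.hitsA (constIdx-enumerates A))

  tag-injective : ∀ m m' → E (tag m) (tag m') → m ≡ m'
  tag-injective zero zero e = refl
  tag-injective zero (suc m') e = ⊥-elim (empty≁single {tag m'} e)
  tag-injective (suc m) zero e = ⊥-elim (empty≁single {tag m} (E-sym e))
  tag-injective (suc m) (suc m') e = cong suc (tag-injective m m' (to (single-iff {tag m} {tag m'}) e))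

  successor-step : (R : Rel ℕ 0ℓ) {b : ℕ} → 1 ≤ b → (∀ u u' → R u u' ⇔ E (H b u) (H b u')) →
                   ∀ x y → (R ⁺) x y ⇔ E (H (2 ^ b) x) (H (2 ^ b) y)
  successor-step R {b} 1≤b ih x y =
    subst₂ (λ u w → (R ⁺) x y ⇔ E u w) (sym (H-2^ b 1≤b x)) (sym (H-2^ b 1≤b y))
      (⇔.trans (⁺-transport R (H b) ih C (idxComp-⇓ {q} (H-index b)) (idxComp-⇑ {q} (H-index b)) x y)
               (r-reduces (C x) (C y)))
    where
    q = curryIdx P b
    C = idxComp q

  limit-step : ∀ e (f : ℕ → ℕ) → (∀ m → φ e [ m ]⇓ f m) → (R : ℕ → Rel ℕ 0ℓ) →
               (∀ m u u' → R m u u' ⇔ E (H (f m) u) (H (f m) u')) →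
               ∀ x y → (π₁ x ≡ π₁ y × R (π₁ x) (π₂ x) (π₂ y)) ⇔ E (H (3 * 5 ^ e) x) (H (3 * 5 ^ e) y)
  limit-step e f f-computed R ih x y =
    subst₂ (λ u w → (π₁ x ≡ π₁ y × R (π₁ x) (π₂ x) (π₂ y)) ⇔ E u w) (sym (H-3·5^ e x)) (sym (H-3·5^ e y))
      (⇔.trans (mk⇔ forth back)
               (⇔.sym (kpair-iff {tag (π₁ x)} {r (limitIdx P e x)} {tag (π₁ y)} {r (limitIdx P e y)})))
    where
    components : E (r (limitIdx P e x)) (r (limitIdx P e y)) ⇔ E (H (f (π₁ x)) (π₂ x)) (H (f (π₁ y)) (π₂ y))
    components = r-one (limitIdx-enumerates {P} {e} {f} {H} f-computed H-computes x)
                       (limitIdx-enumerates {P} {e} {f} {H} f-computed H-computes y)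
    fibre : π₁ x ≡ π₁ y → R (π₁ x) (π₂ x) (π₂ y) ⇔ E (H (f (π₁ x)) (π₂ x)) (H (f (π₁ y)) (π₂ y))
    fibre eq = subst (λ m → R (π₁ x) (π₂ x) (π₂ y) ⇔ E (H (f (π₁ x)) (π₂ x)) (H (f m) (π₂ y))) eq
                     (ih (π₁ x) (π₂ x) (π₂ y))
    forth : π₁ x ≡ π₁ y × R (π₁ x) (π₂ x) (π₂ y) →
            E (tag (π₁ x)) (tag (π₁ y)) × E (r (limitIdx P e x)) (r (limitIdx P e y))
    forth (eq , rel) = subst (λ m → E (tag (π₁ x)) (tag m)) eq E-refl , from components (to (fibre eq) rel)
    back : E (tag (π₁ x)) (tag (π₁ y)) × E (r (limitIdx P e x)) (r (limitIdx P e y)) →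
           π₁ x ≡ π₁ y × R (π₁ x) (π₂ x) (π₂ y)
    back (t , c) = eq , from (fibre eq) (to components c)
      where
      eq : π₁ x ≡ π₁ y
      eq = tag-injective _ _ t

  reduces : ∀ {a} (p : 𝒪 a) x y → jump E p x y ⇔ E (H a x) (H a y)
  reduces one x y = subst₂ (λ u w → E x y ⇔ E u w) (sym (H-1 x)) (sym (H-1 y)) ⇔.refl
  reduces (sucO p) = successor-step (jump E p) (𝒪-positive p) (reduces p)
  reduces (limO e f f-computed o _) =
    limit-step e f f-computed (λ m → jump E (o m)) (λ m → reduces (o m))

  jump-reduces : ∀ {a} (p : 𝒪 a) → jump E p ≤c E
  jump-reduces {a} p = H a , (curryIdx P a , H-index a) , reduces p

proposition2p6 : (E : Rel ℕ 0ℓ) → IsEquivalence E → (E ⁺) ≤c E →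
                 ∀ {a} (p : 𝒪 a) → jump E p ≤c E
proposition2p6 E E-equiv (r , (rIdx , r-computes) , r-reduces) =
  Reduction.jump-reduces E E-equiv r rIdx r-computes r-reduces
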